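{- Let $(S,\circ,BB)$ be an Assembly Space. Then for every object $\mathscr{O}\in S$, \[ \big\lceil \log_2\big(s(\mathscr{O})\big)\big\rceil\;\le\;\ell\big(s(\mathscr{O})\big)\;\le\; a(\mathscr{O}). \]
   Context: Addition chains: for $n\in\mathbb{Z}^+$, an addition chain for $n$ is a sequence of positive integers $(a_0,a_1,\dots,a_r)$ with $a_0=1$, $a_r=n$ and, for each $i\in\{1,\dots,r\}$, $a_i=a_j+a_k$ for some $j,k\in\{0,\dots,i-1\}$. $\ell(n)$ denotes the minimal $r$ (number of additions) over all addition chains for $n$; in particular $\ell(1)=0$, $\ell(7)=4$. A Multi-Magma $(S,\circ)$ is a set $S$ together with a binary operation $\circ:2^S\times 2^S\to 2^S$; for $x,y\in S$, $\{x\}\circ\{y\}\subseteq S$. A subset $BB\subseteq S$ is fixed as the set of Building Blocks. Assembly Addition Chains: for $\mathscr{O}\in S\setminus BB$, an Assembly Addition Chain (AAC) of $\mathscr{O}$ is a finite sequence $(\mathscr{O}_1,\dots,\mathscr{O}_r)$ of elements of $S$ with $\mathscr{O}_r=\mathscr{O}$, $\mathscr{O}_1\in\{\mathscr{B}\}\circ\{\mathscr{B}'\}$ for some $\mathscr{B},\mathscr{B}'\in BB$, and such that for each $\rho\in\{2,\dots,r\}$ there exist $\mathscr{O}_\sigma,\mathscr{O}_\tau\in\{\mathscr{O}_1,\dots,\mathscr{O}_{\rho-1}\}\cup BB$ with $\mathscr{O}_\rho\in\{\mathscr{O}_\sigma\}\circ\{\mathscr{O}_\tau\}$. Its length is $r$.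 $AAC(\mathscr{O})$ denotes the set of all such chains. Assembly Multi-Magma: $(S,\circ,BB)$ is an Assembly Multi-Magma if for every $\mathscr{O}\in S\setminus BB$: (1) there exist $\mathscr{B}_0,\dots,\mathscr{B}_r\in BB$ and an AAC $\Gamma(\mathscr{O})=(\mathscr{O}_1,\dots,\mathscr{O}_r=\mathscr{O})$ with $\mathscr{O}_1\in\{\mathscr{B}_0\}\circ\{\mathscr{B}_1\}$ and $\mathscr{O}_i\in\{\mathscr{O}_{i-1}\}\circ\{\mathscr{B}_i\}$ for $i=2,\dots,r$; (2) any other such chain built in the same way from building blocks $\overline{\mathscr{B}}_0,\dots,\overline{\mathscr{B}}_s$ has $s=r$ and the $\overline{\mathscr{B}}_j$ are a permutation of the $\mathscr{B}_i$. Size: $s(\mathscr{O})=1$ if $\mathscr{O}\in BB$ and $s(\mathscr{O})=r+1$ (with $r$ the length of $\Gamma(\mathscr{O})$) otherwise. Assembly Space: an Assembly Multi-Magma such that whenever $\mathscr{O}\in S\setminus BB$ and $\mathscr{O}\in\{\mathscr{O}_\sigma\}\circ\{\mathscr{O}_\tau\}$, we have $s(\mathscr{O})=s(\mathscr{O}_\sigma)+s(\mathscr{O}_\tau)$. Assembly Index: $a(\mathscr{O})=0$ if $\mathscr{O}\in BB$, and otherwise $a(\mathscr{O})$ is the minimum length of an element of $AAC(\mathscr{O})$. -}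

module Defs where

open import Data.Nat using (ℕ; zero; suc; _+_; _≤_; _>_)
open import Data.Fin as Fin using (Fin; fromℕ; toℕ)
open import Data.List using (List; []; _∷_; length)
open import Data.List.Relation.Binary.Permutation.Propositional using (_↭_)
open import Data.Product using (Σ; ∃; ∃-syntax; _×_)
open import Data.Sum using (_⊎_)
open import Relation.Nullary using (¬_)
open import Data.Empty using (⊥)
open import Relation.Binary.PropositionalEquality using (_≡_)

AdditionChain : ℕ → ℕ → Set
AdditionChain n r =
  Σ (Fin (suc r) → ℕ) λ a →
    (a Fin.zero ≡ 1) × (a (fromℕ r) ≡ n) ×
    (∀ (i : Fin (suc r)) → toℕ i > 0 →
       ∃[ j ] ∃[ k ] (j Fin.< i) × (k Fin.< i) × (a i ≡ a j + a k))

IsChainLength : ℕ → ℕ → Set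
IsChainLength n r = AdditionChain n r × (∀ r′ → AdditionChain n r′ → r ≤ r′)

-- Multi-magmas with building blocks.
-- The multi-valued operation is given on singletons as a relation:
-- Op x y z  means  z ∈ {x} ∘ {y}.

record MultiMagmaBB : Set₁ where
  field
    S  : Set
    Op : S → S → S → Set
    BB : S → Set

module _ (M : MultiMagmaBB) where
  open MultiMagmaBB M

  -- Linear chains of condition (1):  Lin O bs  means O = O_r is obtained by
  -- O_1 ∈ {B_0}∘{B_1}, O_i ∈ {O_{i-1}}∘{B_i}; bs = B_r ∷ … ∷ B_1 ∷ B_0 ∷ []
  -- (so  length bs = r + 1).
  data Lin : S → List S → Set where
    base : ∀ {b₀ b₁ o} → BB b₀ → BB b₁ → Op b₀ b₁ o → Lin o (b₁ ∷ b₀ ∷ [])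
    step : ∀ {o′ bs b o} → Lin o′ bs → BB b → Op o′ b o → Lin o (b ∷ bs)

  -- Assembly Addition Chains of O of length r = suc m:
  -- (O_1, …, O_r) encoded as c : Fin (suc m) → S (c i = O_{i+1}).
  Available : ∀ {m} → (Fin (suc m) → S) → Fin (suc m) → S → Set
  Available c i x = BB x ⊎ ∃[ j ] (j Fin.< i) × (c j ≡ x)

  AAC : S → ℕ → Set
  AAC O zero    = ⊥
  AAC O (suc m) =
    ¬ BB O ×
    Σ (Fin (suc m) → S) λ c →
      (c (fromℕ m) ≡ O) ×
      (∀ i → ∃[ x ] ∃[ y ] Available c i x × Available c i y × Op x y (c i))

  HasSize : S → ℕ → Set
  HasSize O n = (BB O × n ≡ 1) ⊎ (¬ BB O × ∃[ bs ] Lin O bs × n ≡ length bs)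

  IsAssemblyIndex : S → ℕ → Set
  IsAssemblyIndex O k =
    (BB O × k ≡ 0) ⊎ (¬ BB O × AAC O k × (∀ k′ → AAC O k′ → k ≤ k′))

record AssemblyMultiMagma : Set₁ where
  field
    magma : MultiMagmaBB
  open MultiMagmaBB magma public
  field
    linear-exists : ∀ O → ¬ BB O → ∃[ bs ] Lin magma O bs
    linear-unique : ∀ {O bs bs′} → ¬ BB O → Lin magma O bs → Lin magma O bs′ → bs ↭ bs′

record AssemblySpace : Set₁ where
  field
    multiMagma : AssemblyMultiMagma
  open AssemblyMultiMagma multiMagma public
  field
    size-additive : ∀ {O x y n m k} → ¬ BB O → Op x y O →
      HasSize magma O n → HasSize magma x m → HasSize magma y k → n ≡ m + k

{-# OPTIONS --safe #-}
-- Each step of an addition chain at most doubles its largest entry, so an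
-- addition chain for n with r steps has n ≤ 2 ^ r.  Conversely, replacing every
-- object of an assembly chain of O by its size gives an addition chain for
-- s(O) of the same length, because sizes add up along ∘; a building block that
-- occurs inside the chain is replaced by 2 = 1 + 1.  Membership in BB is not
-- decidable, so this addition chain is only obtained under double negation,
-- which is enough to conclude the decidable inequality ℓ(s(O)) ≤ a(O).
module Submission where

open import Defs
open import Data.Nat using (ℕ; suc; _+_; _^_; _≤_; _>_; z<s; s≤s; s≤s⁻¹; _≤?_)
open import Data.Nat.Properties
  using (≤-trans; ≤-reflexive; +-mono-≤; +-identityʳ; m^n>0; module ≤-Reasoning)
open import Data.Nat.Logarithm using (⌈log₂_⌉; ⌈log₂⌉-mono-≤; ⌈log₂2^n⌉≡n)
open import Data.Fin as Fin using (Fin; zero; suc; fromℕ; toℕ)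
open import Data.Fin.Properties using (toℕ-fromℕ; sequence)
open import Data.List using (length)
open import Data.List.Relation.Binary.Permutation.Propositional.Properties using (↭-length)
open import Data.Product using (∃-syntax; _×_; _,_; proj₁; proj₂)
open import Data.Sum using (inj₁; inj₂)
open import Data.Empty using (⊥-elim)
open import Effect.Monad using (RawMonad)
open import Relation.Nullary using (¬_; Dec; yes; no)
open import Relation.Nullary.Decidable using (decidable-stable; ¬¬-excluded-middle)
open import Relation.Nullary.Negation using (¬¬-map; ¬¬-Monad)
open import Relation.Binary.PropositionalEquality using (_≡_; refl; sym; trans; subst; cong)

n≤2^length : ∀ {n r} → AdditionChain n r → n ≤ 2 ^ r
n≤2^length {n} {r} (a , a₀≡1 , aᵣ≡n , a-step) =
  subst (_≤ 2 ^ r) aᵣ≡n (entry≤2^ r (fromℕ r) (≤-reflexive (toℕ-fromℕ r)))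
  where
  open ≤-Reasoning

  entry≤2^ : ∀ k i → toℕ i ≤ k → a i ≤ 2 ^ k
  entry≤2^ k       zero    _ = subst (_≤ 2 ^ k) (sym a₀≡1) (m^n>0 2 k)
  entry≤2^ (suc k) (suc i) i≤k with a-step (suc i) z<s
  ... | j , j′ , j<i , j′<i , aᵢ≡aⱼ+aⱼ′ = begin
    a (suc i)         ≡⟨ aᵢ≡aⱼ+aⱼ′ ⟩
    a j + a j′        ≤⟨ +-mono-≤ (entry≤2^ k j (below j<i)) (entry≤2^ k j′ (below j′<i)) ⟩
    2 ^ k + 2 ^ k     ≡⟨ cong (2 ^ k +_) (sym (+-identityʳ (2 ^ k))) ⟩
    2 ^ suc k         ∎
    where
    below : ∀ {x} → x Fin.< suc i → toℕ x ≤ k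
    below x<i = ≤-trans (s≤s⁻¹ x<i) (s≤s⁻¹ i≤k)

⌈log₂⌉≤length : ∀ {n r} → AdditionChain n r → ⌈log₂ n ⌉ ≤ r
⌈log₂⌉≤length {n} {r} chain =
  subst (⌈log₂ n ⌉ ≤_) (⌈log₂2^n⌉≡n r) (⌈log₂⌉-mono-≤ (n≤2^length chain))

additionChain-1 : AdditionChain 1 0
additionChain-1 = (λ _ → 1) , refl , refl , λ { zero () }

¬¬-decidable : ∀ {k} (P : Fin k → Set) → ¬ ¬ (∀ i → Dec (P i))
¬¬-decidable P = sequence (RawMonad.rawApplicative ¬¬-Monad) (λ _ → ¬¬-excluded-middle)

module _ (A : AssemblySpace) where
  open AssemblySpace A

  HasSize-functional : ∀ {X p q} → HasSize magma X p → HasSize magma X q → p ≡ q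
  HasSize-functional (inj₁ (_ , p≡1)) (inj₁ (_ , q≡1)) = trans p≡1 (sym q≡1)
  HasSize-functional (inj₁ (b , _)) (inj₂ (¬b , _)) = ⊥-elim (¬b b)
  HasSize-functional (inj₂ (¬b , _)) (inj₁ (b , _)) = ⊥-elim (¬b b)
  HasSize-functional (inj₂ (¬b , _ , Γ , p≡∣bs∣)) (inj₂ (_ , _ , Γ′ , q≡∣bs′∣)) =
    trans p≡∣bs∣ (trans (↭-length (linear-unique ¬b Γ Γ′)) (sym q≡∣bs′∣))

  size : ∀ X → ¬ BB X → ℕ
  size X ¬b = length (proj₁ (linear-exists X ¬b))

  size-HasSize : ∀ {X} (¬b : ¬ BB X) → HasSize magma X (size X ¬b)
  size-HasSize {X} ¬b = inj₂ (¬b , proj₁ (linear-exists X ¬b) , proj₂ (linear-exists X ¬b) , refl)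

  weight : ∀ X → Dec (BB X) → ℕ
  weight X (yes _) = 2
  weight X (no ¬b) = size X ¬b

  weight-HasSize : ∀ {X} → ¬ BB X → (b? : Dec (BB X)) → HasSize magma X (weight X b?)
  weight-HasSize ¬b (yes b) = ⊥-elim (¬b b)
  weight-HasSize _  (no ¬b) = size-HasSize ¬b

  module FromAAC {O m} (c : Fin (suc m) → S) (c-last : c (fromℕ m) ≡ O)
    (c-step : ∀ i → ∃[ x ] ∃[ y ] Available magma c i x × Available magma c i y × Op x y (c i))
    (BB? : ∀ i → Dec (BB (c i))) where

    entries : Fin (suc (suc m)) → ℕ
    entries zero    = 1
    entries (suc i) = weight (c i) (BB? i)

    available-size : ∀ {i x} → Available magma c i x →
      ∃[ j ] j Fin.< suc i × HasSize magma x (entries j)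
    available-size (inj₁ b) = zero , z<s , inj₁ (b , refl)
    available-size (inj₂ (j , j<i , refl)) with BB? j
    ... | yes b  = zero , z<s , inj₁ (b , refl)
    ... | no ¬b  = suc j , s≤s j<i , weight-HasSize ¬b (BB? j)

    entries-step : ∀ i → toℕ i > 0 →
      ∃[ j ] ∃[ k ] (j Fin.< i) × (k Fin.< i) × (entries i ≡ entries j + entries k)
    entries-step (suc i) _ with BB? i | c-step i
    ... | yes _ | _ = zero , zero , z<s , z<s , refl
    ... | no ¬b | x , y , x-avail , y-avail , op
      with available-size x-avail | available-size y-avail
    ... | j , j<i , x-size | k , k<i , y-size =
      j , k , j<i , k<i , size-additive ¬b op (size-HasSize ¬b) x-size y-size

    additionChain : ∀ {n} → ¬ BB O → HasSize magma O n → AdditionChain n (suc m)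
    additionChain {n} ¬bO O-size = entries , refl , entries-last , entries-step
      where
      ¬b-last : ¬ BB (c (fromℕ m))
      ¬b-last b = ¬bO (subst BB c-last b)

      entries-last : entries (fromℕ (suc m)) ≡ n
      entries-last = HasSize-functional (weight-HasSize ¬b-last (BB? (fromℕ m)))
        (subst (λ X → HasSize magma X n) (sym c-last) O-size)

  AAC⇒¬¬AdditionChain : ∀ {O n r} → HasSize magma O n → AAC magma O r → ¬ ¬ AdditionChain n r
  AAC⇒¬¬AdditionChain {r = suc m} O-size (¬bO , c , c-last , c-step) =
    ¬¬-map (λ BB? → FromAAC.additionChain c c-last c-step BB? ¬bO O-size)
           (¬¬-decidable (λ i → BB (c i)))

  assemblyIndex⇒¬¬AdditionChain : ∀ {O n a} →
    HasSize magma O n → IsAssemblyIndex magma O a → ¬ ¬ AdditionChain n a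
  assemblyIndex⇒¬¬AdditionChain (inj₁ (_ , refl)) (inj₁ (_ , refl)) ¬chain = ¬chain additionChain-1
  assemblyIndex⇒¬¬AdditionChain (inj₂ (¬b , _)) (inj₁ (b , _)) = ⊥-elim (¬b b)
  assemblyIndex⇒¬¬AdditionChain O-size (inj₂ (_ , aac , _)) = AAC⇒¬¬AdditionChain O-size aac

theorem1 : (A : AssemblySpace) → let open AssemblySpace A in
    ∀ (O : S) (n l a : ℕ) → HasSize magma O n → IsChainLength n l → IsAssemblyIndex magma O a →
      (⌈log₂ n ⌉ ≤ l) × (l ≤ a)
theorem1 A O n l a O-size (chain , minimal) O-index =
  ⌈log₂⌉≤length chain ,
  decidable-stable (l ≤? a) (¬¬-map (minimal a) (assemblyIndex⇒¬¬AdditionChain A O-size O-index))
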